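{- Let $G$ be a multigraph of even order $n$, let $\Delta = \Delta(G)$, let $S \subseteq V(G)$ with $|S|$ odd and $|S| \geq 3$, and let $F$ be a 1-factor (perfect matching) of $G$. Then $$\mathrm{ex}(\langle S\rangle, \Delta - 1; G - F) \leq \mathrm{ex}(\langle S\rangle, \Delta; G) + \min\{(n-|S|-1)/2,\ (|S|-1)/2\}.$$
   Context: Multigraphs are finite and loopless, with parallel edges allowed. For a multigraph $G$ and $S\subseteq V(G)$, $\langle S\rangle$ (or $\langle S\rangle; G$ to stress the host multigraph) denotes the subgraph of $G$ induced by $S$; $G-F$ denotes $G$ with the edges of $F$ deleted. For an integer $k$ and a multigraph $H$ of odd order $n(H)\ge 3$ with $e(H)$ edges, the $k$-excess is $\mathrm{ex}(H,k) = e(H) - k(n(H)-1)/2$; $\mathrm{ex}(\langle S\rangle, k; G)$ denotes the $k$-excess of the subgraph of $G$ induced by $S$. -}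

module Defs where

open import Data.Nat using (ℕ; zero; suc; _+_; _*_; _∸_; _⊔_; _⊓_; _<_; _≤_; _<ᵇ_)
open import Data.Bool using (Bool; true; false; if_then_else_; _∧_)
open import Data.Fin using (Fin; toℕ; _≟_)
open import Data.Fin.Subset using (Subset; _∈_; ∣_∣)
open import Data.Fin.Subset.Properties using (_∈?_)
open import Data.List using (List; map; foldr; allFin)
open import Data.Nat.ListAction using (sum)
open import Data.Integer as ℤ using (ℤ; +_)
open import Relation.Nullary.Decidable using (⌊_⌋)
open import Relation.Binary.PropositionalEquality using (_≡_; _≢_)

record Multigraph (n : ℕ) : Set where
  field
    mult     : Fin n → Fin n → ℕ
    symm     : ∀ i j → mult i j ≡ mult j i
    loopless : ∀ i → mult i i ≡ 0
open Multigraph public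

degree : ∀ {n} → Multigraph n → Fin n → ℕ
degree G i = sum (map (mult G i) (allFin _))

maxDegree : ∀ {n} → Multigraph n → ℕ
maxDegree G = foldr _⊔_ 0 (map (degree G) (allFin _))

record OneFactor {n : ℕ} (G : Multigraph n) : Set where
  field
    partner    : Fin n → Fin n
    involutive : ∀ i → partner (partner i) ≡ i
    noFixed    : ∀ i → partner i ≢ i
    isEdge     : ∀ i → 1 ≤ mult G i (partner i)
open OneFactor public

deleteFactor : ∀ {n} (G : Multigraph n) → OneFactor G → Multigraph n
deleteFactor G F = record
  { mult     = λ i j → mult G i j ∸ (if ⌊ partner F i ≟ j ⌋ then 1 else 0)
  ; symm     = symmPf
  ; loopless = loopPf
  }
  where
  open import Relation.Binary.PropositionalEquality
  open import Relation.Nullary using (yes; no)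
  symmPf : ∀ i j → mult G i j ∸ (if ⌊ partner F i ≟ j ⌋ then 1 else 0)
                 ≡ mult G j i ∸ (if ⌊ partner F j ≟ i ⌋ then 1 else 0)
  symmPf i j with partner F i ≟ j | partner F j ≟ i
  ... | yes _ | yes _ = cong (_∸ 1) (symm G i j)
  ... | no _  | no _  = cong (_∸ 0) (symm G i j)
  ... | yes p | no q  = ⊥-elim' (q (trans (cong (partner F) (sym p)) (involutive F i)))
    where open import Data.Empty renaming (⊥-elim to ⊥-elim')
  ... | no p  | yes q = ⊥-elim' (p (trans (cong (partner F) (sym q)) (involutive F j)))
    where open import Data.Empty renaming (⊥-elim to ⊥-elim')
  loopPf : ∀ i → mult G i i ∸ (if ⌊ partner F i ≟ i ⌋ then 1 else 0) ≡ 0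
  loopPf i rewrite loopless G i = 0∸n≡0 (if ⌊ partner F i ≟ i ⌋ then 1 else 0)
    where open import Data.Nat.Properties using (0∸n≡0)

inducedEdges : ∀ {n} → Multigraph n → Subset n → ℕ
inducedEdges {n} G S =
  sum (map (λ i → sum (map (λ j →
    if ⌊ i ∈? S ⌋ ∧ ⌊ j ∈? S ⌋ ∧ (toℕ i <ᵇ toℕ j) then mult G i j else 0)
    (allFin n))) (allFin n))

-- Twice the k-excess of ⟨S⟩ in G:
--   2 · ex(⟨S⟩, k; G) = 2 e(⟨S⟩) - k (|S| - 1)
-- (the excess itself may be a half-integer; we work with twice it in ℤ)
twiceExcess : ∀ {n} → Multigraph n → Subset n → ℕ → ℤ
twiceExcess G S k = + (2 * inducedEdges G S) ℤ.- + (k * (∣ S ∣ ∸ 1))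

open import Data.Product using (∃)

IsEven : ℕ → Set
IsEven m = ∃ λ k → m ≡ 2 * k

IsOdd : ℕ → Set
IsOdd m = ∃ λ k → m ≡ suc (2 * k)

-- Deleting the 1-factor F lowers 2e(⟨S⟩) by the number I of vertices of S
-- matched inside S, whereas lowering k from Δ to Δ - 1 raises 2·ex by |S| - 1.
-- The other |S| - I vertices of S are matched injectively (F is an involution)
-- into the complement of S, so |S| - I ≤ n - |S|; hence
-- |S| - 1 ≤ I + min (n - |S| - 1, |S| - 1), which is the bound.
module Submission where

open import Defs
open import Data.Nat using (ℕ; _*_; _∸_; _⊓_; _≤_)
open import Data.Fin.Subset using (Subset; ∣_∣)
open import Data.Integer as ℤ using (ℤ; +_)

open import Data.Nat using (zero; suc; _+_; _<ᵇ_; z≤n)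
open import Data.Nat.Properties hiding (_≟_)
open import Data.Bool using (Bool; true; false; if_then_else_; _∧_; not)
open import Data.Fin using (Fin; toℕ) renaming (zero to fzero; suc to fsuc)
open import Data.Fin.Properties using (_≟_; toℕ-injective)
open import Data.Fin.Permutation using (permutation)
open import Data.Fin.Subset using (inside; outside)
open import Data.Fin.Subset.Properties using (_∈?_)
open import Data.List using (map; allFin; tabulate)
open import Data.List.Properties using (map-tabulate)
import Data.Nat.ListAction as List
open import Data.Vec using ([]; _∷_)
open import Algebra.Properties.CommutativeMonoid.Sum +-0-commutativeMonoid
  using (sum-syntax; sum-cong-≗; sum-replicate-zero; ∑-distrib-+; ∑-permute)
open import Data.Integer.Solver using (module +-*-Solver)
import Data.Integer.Properties as ℤ
open import Relation.Nullary.Decidable using (yes; no; ⌊_⌋; ⌊⌋-map′)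
open import Relation.Nullary.Reflects using (ofʸ; ofⁿ)
open import Relation.Binary.PropositionalEquality
open import Data.Empty using (⊥-elim)
open import Function using (_∘_; id)

sum-map-allFin : ∀ n (f : Fin n → ℕ) → List.sum (map f (allFin n)) ≡ ∑[ i < n ] f i
sum-map-allFin n f = trans (cong List.sum (map-tabulate id f)) (sum-tabulate n f)
  where
  sum-tabulate : ∀ n (f : Fin n → ℕ) → List.sum (tabulate f) ≡ ∑[ i < n ] f i
  sum-tabulate zero    f = refl
  sum-tabulate (suc n) f = cong (_+_ (f fzero)) (sum-tabulate n (f ∘ fsuc))

𝟙 : Bool → ℕ
𝟙 b = if b then 1 else 0

count : ∀ {n} → (Fin n → Bool) → ℕ
count {n} P = ∑[ i < n ] 𝟙 (P i)

count-cong : ∀ {n} {P Q : Fin n → Bool} → (∀ i → P i ≡ Q i) → count P ≡ count Q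
count-cong P≗Q = sum-cong-≗ (cong 𝟙 ∘ P≗Q)

count-true : ∀ n → count {n} (λ _ → true) ≡ n
count-true zero    = refl
count-true (suc n) = cong suc (count-true n)

count-split : ∀ {n} (P Q : Fin n → Bool) →
  count (λ i → P i ∧ Q i) + count (λ i → P i ∧ not (Q i)) ≡ count P
count-split P Q = trans (sym (∑-distrib-+ (λ i → 𝟙 (P i ∧ Q i)) (λ i → 𝟙 (P i ∧ not (Q i)))))
                        (sum-cong-≗ λ i → 𝟙-split (P i) (Q i))
  where
  𝟙-split : ∀ b c → 𝟙 (b ∧ c) + 𝟙 (b ∧ not c) ≡ 𝟙 b
  𝟙-split true  true  = refl
  𝟙-split true  false = refl
  𝟙-split false _     = refl

count-not : ∀ {n} (P : Fin n → Bool) → count (not ∘ P) ≡ n ∸ count P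
count-not {n} P = begin
  count (not ∘ P)                          ≡⟨ m+n∸m≡n (count P) (count (not ∘ P)) ⟨
  count P + count (not ∘ P) ∸ count P      ≡⟨ cong (_∸ count P) (count-split (λ _ → true) P) ⟩
  count {n} (λ _ → true) ∸ count P         ≡⟨ cong (_∸ count P) (count-true n) ⟩
  n ∸ count P                              ∎
  where open ≡-Reasoning

count-∧-≤ʳ : ∀ {n} (P Q : Fin n → Bool) → count (λ i → P i ∧ Q i) ≤ count Q
count-∧-≤ʳ {zero}  P Q = z≤n
count-∧-≤ʳ {suc n} P Q =
  +-mono-≤ (𝟙-∧-≤ʳ (P fzero) (Q fzero)) (count-∧-≤ʳ (P ∘ fsuc) (Q ∘ fsuc))
  where
  𝟙-∧-≤ʳ : ∀ b c → 𝟙 (b ∧ c) ≤ 𝟙 c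
  𝟙-∧-≤ʳ true  c = ≤-refl
  𝟙-∧-≤ʳ false c = z≤n

count-≟-∧ : ∀ {n} (k : Fin n) (P : Fin n → Bool) → count (λ j → ⌊ k ≟ j ⌋ ∧ P j) ≡ 𝟙 (P k)
count-≟-∧ {suc n} fzero    P = trans (cong (_+_ (𝟙 (P fzero))) (sum-replicate-zero n)) (+-identityʳ _)
count-≟-∧ {suc n} (fsuc k) P = trans
  (count-cong {Q = λ j → ⌊ k ≟ j ⌋ ∧ P (fsuc j)} λ j → cong (_∧ P (fsuc j)) (⌊⌋-map′ _ _ (k ≟ j)))
  (count-≟-∧ k (P ∘ fsuc))

_∈ᵇ_ : ∀ {n} → Fin n → Subset n → Bool
i ∈ᵇ S = ⌊ i ∈? S ⌋

fsuc-∈ᵇ : ∀ {n} x (S : Subset n) i → fsuc i ∈ᵇ (x ∷ S) ≡ i ∈ᵇ S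
fsuc-∈ᵇ x S i = ⌊⌋-map′ _ _ (i ∈? S)

∣∣≡count-∈ᵇ : ∀ {n} (S : Subset n) → ∣ S ∣ ≡ count (_∈ᵇ S)
∣∣≡count-∈ᵇ []            = refl
∣∣≡count-∈ᵇ (inside  ∷ S) = cong suc (trans (∣∣≡count-∈ᵇ S) (count-cong (sym ∘ fsuc-∈ᵇ inside S)))
∣∣≡count-∈ᵇ (outside ∷ S) = trans (∣∣≡count-∈ᵇ S) (count-cong (sym ∘ fsuc-∈ᵇ outside S))

<ᵇ-flip : ∀ {m n} → m ≢ n → (n <ᵇ m) ≡ not (m <ᵇ n)
<ᵇ-flip {m} {n} m≢n with m <ᵇ n | <ᵇ-reflects-< m n | n <ᵇ m | <ᵇ-reflects-< n m
... | true  | ofʸ m<n | true  | ofʸ n<m = ⊥-elim (<-asym m<n n<m)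
... | true  | _       | false | _       = refl
... | false | _       | true  | _       = refl
... | false | ofⁿ m≮n | false | ofⁿ n≮m = ⊥-elim (m≢n (≤-antisym (≮⇒≥ n≮m) (≮⇒≥ m≮n)))

module _ {n} {p : Fin n → Fin n} (p-involutive : ∀ i → p (p i) ≡ i) where

  count-∘-involution : (P : Fin n → Bool) → count (P ∘ p) ≡ count P
  count-∘-involution P = sym (∑-permute (𝟙 ∘ P) (permutation p p p-involutive p-involutive))

  count-leaving≤∣∁∣ : (S : Subset n) → count (λ i → i ∈ᵇ S ∧ not (p i ∈ᵇ S)) ≤ n ∸ ∣ S ∣
  count-leaving≤∣∁∣ S = begin
    count (λ i → i ∈ᵇ S ∧ not (p i ∈ᵇ S))        ≡⟨ count-∘-involution _ ⟨
    count (λ i → p i ∈ᵇ S ∧ not (p (p i) ∈ᵇ S))  ≡⟨ count-cong (λ i → cong (λ j → p i ∈ᵇ S ∧ not (j ∈ᵇ S)) (p-involutive i)) ⟩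
    count (λ i → p i ∈ᵇ S ∧ not (i ∈ᵇ S))        ≤⟨ count-∧-≤ʳ (λ i → p i ∈ᵇ S) (λ i → not (i ∈ᵇ S)) ⟩
    count (λ i → not (i ∈ᵇ S))                   ≡⟨ count-not (_∈ᵇ S) ⟩
    n ∸ count (_∈ᵇ S)                            ≡⟨ cong (n ∸_) (∣∣≡count-∈ᵇ S) ⟨
    n ∸ ∣ S ∣                                    ∎
    where open ≤-Reasoning

  -- Each pair {i, p i} inside Q is counted once on the left, from its smaller end.
  count-matched-pairs : (∀ i → p i ≢ i) → (Q : Fin n → Bool) →
    2 * count (λ i → Q i ∧ Q (p i) ∧ (toℕ i <ᵇ toℕ (p i))) ≡ count (λ i → Q i ∧ Q (p i))
  count-matched-pairs p-fixfree Q = begin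
    2 * count L                             ≡⟨ cong (_+_ (count L)) (+-identityʳ (count L)) ⟩
    count L + count L                       ≡⟨ cong (_+_ (count L)) (count-∘-involution L) ⟨
    count L + count (L ∘ p)                 ≡⟨ ∑-distrib-+ (𝟙 ∘ L) (𝟙 ∘ L ∘ p) ⟨
    ∑[ i < n ] (𝟙 (L i) + 𝟙 (L (p i)))      ≡⟨ sum-cong-≗ ends ⟩
    count (λ i → Q i ∧ Q (p i))             ∎
    where
    open ≡-Reasoning
    L : Fin n → Bool
    L i = Q i ∧ Q (p i) ∧ (toℕ i <ᵇ toℕ (p i))
    𝟙-ends : ∀ a b c → 𝟙 (a ∧ b ∧ c) + 𝟙 (b ∧ a ∧ not c) ≡ 𝟙 (a ∧ b)
    𝟙-ends true  true  true  = refl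
    𝟙-ends true  true  false = refl
    𝟙-ends true  false _     = refl
    𝟙-ends false true  _     = refl
    𝟙-ends false false _     = refl
    ends : ∀ i → 𝟙 (L i) + 𝟙 (L (p i)) ≡ 𝟙 (Q i ∧ Q (p i))
    ends i rewrite p-involutive i
                 | <ᵇ-flip {toℕ i} {toℕ (p i)} (λ eq → p-fixfree i (sym (toℕ-injective eq)))
                 = 𝟙-ends (Q i) (Q (p i)) (toℕ i <ᵇ toℕ (p i))

inducedPair : ∀ {n} → Subset n → Fin n → Fin n → Bool
inducedPair S i j = i ∈ᵇ S ∧ j ∈ᵇ S ∧ (toℕ i <ᵇ toℕ j)

inducedMult : ∀ {n} → Multigraph n → Subset n → Fin n → Fin n → ℕ
inducedMult G S i j = if inducedPair S i j then mult G i j else 0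

inducedEdges-∑ : ∀ {n} (G : Multigraph n) (S : Subset n) →
  inducedEdges G S ≡ ∑[ i < n ] ∑[ j < n ] inducedMult G S i j
inducedEdges-∑ {n} G S =
  trans (sum-map-allFin n _) (sum-cong-≗ λ i → sum-map-allFin n (inducedMult G S i))

module _ {n} (G : Multigraph n) (F : OneFactor G) (S : Subset n) where

  private
    G-F = deleteFactor G F
    p = partner F

  inducedEdges-deleteFactor :
    inducedEdges G S ≡ inducedEdges G-F S + count (λ i → inducedPair S i (p i))
  inducedEdges-deleteFactor = begin
    inducedEdges G S
      ≡⟨ inducedEdges-∑ G S ⟩
    ∑[ i < n ] ∑[ j < n ] inducedMult G S i j
      ≡⟨ sum-cong-≗ (λ i → trans (sum-cong-≗ (split i)) (∑-distrib-+ (inducedMult G-F S i) (𝟙 ∘ deleted i))) ⟩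
    ∑[ i < n ] (∑[ j < n ] inducedMult G-F S i j + count (deleted i))
      ≡⟨ ∑-distrib-+ (λ i → ∑[ j < n ] inducedMult G-F S i j) (count ∘ deleted) ⟩
    ∑[ i < n ] ∑[ j < n ] inducedMult G-F S i j + ∑[ i < n ] count (deleted i)
      ≡⟨ cong₂ _+_ (sym (inducedEdges-∑ G-F S)) (sum-cong-≗ λ i → count-≟-∧ (p i) (inducedPair S i)) ⟩
    inducedEdges G-F S + count (λ i → inducedPair S i (p i))
      ∎
    where
    open ≡-Reasoning
    deleted : Fin n → Fin n → Bool
    deleted i j = ⌊ p i ≟ j ⌋ ∧ inducedPair S i j
    split : ∀ i j → inducedMult G S i j ≡ inducedMult G-F S i j + 𝟙 (deleted i j)
    split i j with inducedPair S i j | p i ≟ j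
    ... | false | yes _    = refl
    ... | false | no  _    = refl
    ... | true  | yes refl = sym (m∸n+n≡m (isEdge F i))
    ... | true  | no  _    = sym (+-identityʳ _)

  twice-inducedEdges-deleteFactor :
    2 * inducedEdges G S ≡ 2 * inducedEdges G-F S + count (λ i → i ∈ᵇ S ∧ p i ∈ᵇ S)
  twice-inducedEdges-deleteFactor = begin
    2 * inducedEdges G S
      ≡⟨ cong (2 *_) inducedEdges-deleteFactor ⟩
    2 * (inducedEdges G-F S + count (λ i → inducedPair S i (p i)))
      ≡⟨ *-distribˡ-+ 2 (inducedEdges G-F S) (count (λ i → inducedPair S i (p i))) ⟩
    2 * inducedEdges G-F S + 2 * count (λ i → inducedPair S i (p i))
      ≡⟨ cong (_+_ (2 * inducedEdges G-F S)) (count-matched-pairs (involutive F) (noFixed F) (_∈ᵇ S)) ⟩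
    2 * inducedEdges G-F S + count (λ i → i ∈ᵇ S ∧ p i ∈ᵇ S)
      ∎
    where open ≡-Reasoning

pred-≤-+-⊓ : ∀ {a b s k} → a + b ≡ s → b ≤ k → s ∸ 1 ≤ a + (k ∸ 1) ⊓ (s ∸ 1)
pred-≤-+-⊓ {a} {b} {s} {k} a+b≡s b≤k =
  subst (s ∸ 1 ≤_) (sym (+-distribˡ-⊓ a (k ∸ 1) (s ∸ 1)))
        (⊓-glb (m≤n+o⇒m∸n≤o s 1 s≤1+a+k∸1) (m≤n+m (s ∸ 1) a))
  where
  open ≤-Reasoning
  s≤1+a+k∸1 : s ≤ suc (a + (k ∸ 1))
  s≤1+a+k∸1 = begin
    s                 ≡⟨ a+b≡s ⟨
    a + b             ≤⟨ +-monoʳ-≤ a (≤-trans b≤k (m≤n+m∸n k 1)) ⟩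
    a + suc (k ∸ 1)   ≡⟨ +-suc a (k ∸ 1) ⟩
    suc (a + (k ∸ 1)) ∎

pos-diff-≤ : ∀ x y z w m → x + w ≤ z + m + y → + x ℤ.- + y ℤ.≤ (+ z ℤ.- + w) ℤ.+ + m
pos-diff-≤ x y z w m x+w≤z+m+y =
  subst₂ ℤ._≤_ (lhs (+ x) (+ y) (+ w)) (rhs (+ z) (+ m) (+ w) (+ y))
         (ℤ.+-monoˡ-≤ (ℤ.- (+ w ℤ.+ + y)) (subst₂ ℤ._≤_ (ℤ.pos-+ x w) z+m+y≡ (ℤ.+≤+ x+w≤z+m+y)))
  where
  open +-*-Solver
  z+m+y≡ : + (z + m + y) ≡ + z ℤ.+ + m ℤ.+ + y
  z+m+y≡ = trans (ℤ.pos-+ (z + m) y) (cong (ℤ._+ + y) (ℤ.pos-+ z m))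
  lhs : ∀ a b c → (a ℤ.+ c) ℤ.+ ℤ.- (c ℤ.+ b) ≡ a ℤ.- b
  lhs = solve 3 (λ a b c → (a :+ c) :+ (:- (c :+ b)) := a :- b) refl
  rhs : ∀ a b c d → (a ℤ.+ b ℤ.+ d) ℤ.+ ℤ.- (c ℤ.+ d) ≡ (a ℤ.- c) ℤ.+ b
  rhs = solve 4 (λ a b c d → (a :+ b :+ d) :+ (:- (c :+ d)) := (a :- c) :+ b) refl

excess-shift : ∀ {x a e} d t m → e ≡ x + a → t ≤ a + m →
  + x ℤ.- + ((d ∸ 1) * t) ℤ.≤ (+ e ℤ.- + (d * t)) ℤ.+ + m
excess-shift {x} {a} d t m refl t≤a+m = pos-diff-≤ x ((d ∸ 1) * t) (x + a) (d * t) m (begin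
  x + d * t                    ≤⟨ +-monoʳ-≤ x (d*t≤t+[d∸1]*t d) ⟩
  x + (t + (d ∸ 1) * t)        ≤⟨ +-monoʳ-≤ x (+-monoˡ-≤ ((d ∸ 1) * t) t≤a+m) ⟩
  x + (a + m + (d ∸ 1) * t)    ≡⟨ +-assoc x (a + m) _ ⟨
  x + (a + m) + (d ∸ 1) * t    ≡⟨ cong (_+ (d ∸ 1) * t) (+-assoc x a m) ⟨
  x + a + m + (d ∸ 1) * t      ∎)
  where
  open ≤-Reasoning
  d*t≤t+[d∸1]*t : ∀ d → d * t ≤ t + (d ∸ 1) * t
  d*t≤t+[d∸1]*t zero    = z≤n
  d*t≤t+[d∸1]*t (suc _) = ≤-refl

mainTheorem2 : (n : ℕ) → IsEven n → (G : Multigraph n) → (S : Subset n) →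
    IsOdd ∣ S ∣ → 3 ≤ ∣ S ∣ → (F : OneFactor G) →
    twiceExcess (deleteFactor G F) S (maxDegree G ∸ 1)
      ℤ.≤ twiceExcess G S (maxDegree G) ℤ.+ + ((n ∸ ∣ S ∣ ∸ 1) ⊓ (∣ S ∣ ∸ 1))
mainTheorem2 n _ G S _ _ F =
  excess-shift (maxDegree G) (∣ S ∣ ∸ 1) ((n ∸ ∣ S ∣ ∸ 1) ⊓ (∣ S ∣ ∸ 1))
               (twice-inducedEdges-deleteFactor G F S)
               (pred-≤-+-⊓ inside+leaving≡∣S∣ (count-leaving≤∣∁∣ (involutive F) S))
  where
  inside+leaving≡∣S∣ : count (λ i → i ∈ᵇ S ∧ partner F i ∈ᵇ S)
                     + count (λ i → i ∈ᵇ S ∧ not (partner F i ∈ᵇ S)) ≡ ∣ S ∣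
  inside+leaving≡∣S∣ = trans (count-split (_∈ᵇ S) (λ i → partner F i ∈ᵇ S)) (sym (∣∣≡count-∈ᵇ S))
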